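{- Let $\mathcal{K}$ be a coronoid and let $C\subseteq G(\mathcal{K})$ be a cycle of length 6. Then every embedding (injective graph homomorphism) $C\hookrightarrow G(\mathcal{H})$ extends to an embedding $G(\mathcal{K})\hookrightarrow G(\mathcal{H})$ in a unique way.
   Context: $\mathcal{H}$ is the set of hexagons of the regular hexagonal tiling of the plane and $G(\mathcal{H})$ is the hexagonal lattice (the graph of vertices and edges of the tiling). Hexagons are adjacent if distinct and share an edge; a set of hexagons is connected if non-empty and any two of its hexagons are joined by a sequence of its hexagons with consecutive ones adjacent. A coronoid is a finite connected $\mathcal{K}\subseteq\mathcal{H}$, and $G(\mathcal{K})$ is the subgraph of $G(\mathcal{H})$ consisting of all vertices and edges lying on some hexagon of $\mathcal{K}$. -}

module Defs where

open import Data.Bool using (Bool; true; false)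
open import Data.Integer using (ℤ; _+_; _-_; 1ℤ)
open import Data.Fin using (Fin; zero; suc)
open import Data.List using (List; [])
open import Data.List.Membership.Propositional using (_∈_)
open import Data.Product using (Σ; ∃; _×_; _,_)
open import Data.Sum using (_⊎_)
open import Relation.Binary.PropositionalEquality using (_≡_)
open import Relation.Nullary using (¬_)

-- Honeycomb (hexagonal lattice) with axial coordinates.
-- A hexagon of the tiling is indexed by ℤ × ℤ.
Hex : Set
Hex = ℤ × ℤ

-- Vertices of G(H): black vertices (true , a , b) and white vertices (false , a , b).
V : Set
V = Bool × ℤ × ℤ

B W : ℤ → ℤ → V
B a b = true , a , b
W a b = false , a , b

data Adj : V → V → Set where
  e₀ : ∀ a b → Adj (W a b) (B a b)
  e₁ : ∀ a b → Adj (W a b) (B (a - 1ℤ) b)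
  e₂ : ∀ a b → Adj (W a b) (B a (b - 1ℤ))
  sym : ∀ {u v} → Adj u v → Adj v u

hexVertex : Hex → Fin 6 → V
hexVertex (a , b) zero = B a b
hexVertex (a , b) (suc zero) = W (a + 1ℤ) b
hexVertex (a , b) (suc (suc zero)) = B (a + 1ℤ) (b - 1ℤ)
hexVertex (a , b) (suc (suc (suc zero))) = W (a + 1ℤ) (b - 1ℤ)
hexVertex (a , b) (suc (suc (suc (suc zero)))) = B a (b - 1ℤ)
hexVertex (a , b) (suc (suc (suc (suc (suc zero))))) = W a b

next : Fin 6 → Fin 6
next zero = suc zero
next (suc zero) = suc (suc zero)
next (suc (suc zero)) = suc (suc (suc zero))
next (suc (suc (suc zero))) = suc (suc (suc (suc zero)))
next (suc (suc (suc (suc zero)))) = suc (suc (suc (suc (suc zero))))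
next (suc (suc (suc (suc (suc zero))))) = zero

VertexOn : Hex → V → Set
VertexOn h u = ∃ λ i → hexVertex h i ≡ u

EdgeOn : Hex → V → V → Set
EdgeOn h u v = ∃ λ i → (hexVertex h i ≡ u × hexVertex h (next i) ≡ v)
                     ⊎ (hexVertex h i ≡ v × hexVertex h (next i) ≡ u)

HexAdj : Hex → Hex → Set
HexAdj h h' = ¬ (h ≡ h') × ∃ λ u → ∃ λ v → EdgeOn h u v × EdgeOn h' u v

-- A finite set of hexagons is given by a list (duplicates irrelevant).
-- Paths of hexagons inside K, consecutive ones adjacent.
data PathIn (K : List Hex) : Hex → Hex → Set where
  here : ∀ {h} → PathIn K h h
  step : ∀ {h h' h''} → h ∈ K → h' ∈ K → HexAdj h h' → PathIn K h' h'' → PathIn K h h''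

Connected : List Hex → Set
Connected K = ¬ (K ≡ []) × (∀ {h h'} → h ∈ K → h' ∈ K → PathIn K h h')

Coronoid : List Hex → Set
Coronoid K = Connected K

VertexK : List Hex → V → Set
VertexK K u = ∃ λ h → h ∈ K × VertexOn h u

EdgeK : List Hex → V → V → Set
EdgeK K u v = ∃ λ h → h ∈ K × EdgeOn h u v

record Cycle6In (K : List Hex) (c : Fin 6 → V) : Set where
  field
    injective : ∀ i j → c i ≡ c j → i ≡ j
    edges     : ∀ i → EdgeK K (c i) (c (next i))

-- an embedding of the cycle C (with vertices c i, edges c i — c (next i))
-- into G(H), given by the images f i of the vertices c i
record Cycle6Embedding (f : Fin 6 → V) : Set where
  field
    injective : ∀ i j → f i ≡ f j → i ≡ j
    edges     : ∀ i → Adj (f i) (f (next i))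

-- an embedding G(K) ↪ G(H): a vertex map (only its values on vertices
-- of G(K) matter) that is injective on V(G(K)) and maps edges to edges
record EmbeddingK (K : List Hex) (g : V → V) : Set where
  field
    injective : ∀ u v → VertexK K u → VertexK K v → g u ≡ g v → u ≡ v
    edges     : ∀ u v → EdgeK K u v → Adj (g u) (g v)

Extends : (Fin 6 → V) → (Fin 6 → V) → (V → V) → Set
Extends c f g = ∀ i → g (c i) ≡ f i

-- Every vertex of the honeycomb has three neighbours, one in each of three directions, and a
-- closed walk of length six without backtracking must turn the same way at every step, so it
-- runs around a hexagon: a 6-cycle of G(H) is determined by three consecutive vertices. The
-- automorphisms of G(H) (translations, the point reflection exchanging the colours, and the
-- reflections permuting the directions at a vertex) act transitively on paths of length two,
-- so some automorphism carries C onto its prescribed image, and its restriction to G(K) is the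
-- required embedding. Conversely two embeddings of G(K) that agree on a path x − u − v with
-- u − v on a hexagon h of K agree on the third neighbour of u on h (degrees are at most three),
-- hence on all of h; this spreads across shared edges of adjacent hexagons, and K is connected.
module Submission where

open import Defs
open import Data.Bool using (Bool; true; false; not)
import Data.Bool.Properties as Bool
open import Data.Empty using (⊥-elim)
open import Data.Fin using (Fin; zero; suc; toℕ)
import Data.Fin.Properties as Fin
open import Data.Integer using (ℤ; _+_; _-_; -_; 0ℤ; 1ℤ)
import Data.Integer.Properties as ℤ
open import Algebra.Properties.AbelianGroup ℤ.+-0-abelianGroup using () renaming (∙-cancelˡ to +-cancelˡ)
open import Data.Integer.Tactic.RingSolver using (solve-∀)
open import Data.List using (List; []; _∷_; map; iterate)
open import Data.List.Membership.Propositional using (_∈_)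
import Data.Nat as ℕ
open ℕ using (ℕ)
open import Data.Product using (Σ; ∃; _×_; _,_; proj₁; proj₂)
open import Data.Product.Properties using (≡-dec)
open import Data.Sum using (_⊎_; inj₁; inj₂)
import Data.Sum as Sum
open import Function using (_∘_)
open import Relation.Binary using (DecidableEquality)
open import Relation.Binary.PropositionalEquality as ≡
  using (_≡_; _≢_; refl; cong; cong₂; subst; subst₂; trans; module ≡-Reasoning)
open import Relation.Nullary using (Dec; yes; no)
open import Relation.Nullary.Decidable using (_→-dec_; _⊎-dec_; ¬?; from-yes)

-- Neighbours in the honeycomb

Dir : Set
Dir = Fin 3

-- W(a,b) is joined to B(a,b) − δ d, where δ 0 = (0,0), δ 1 = (1,0), δ 2 = (0,1).
δx δy : Dir → ℤ
δx zero = 0ℤ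
δx (suc zero) = 1ℤ
δx (suc (suc zero)) = 0ℤ
δy zero = 0ℤ
δy (suc zero) = 0ℤ
δy (suc (suc zero)) = 1ℤ

δ-injective : ∀ {d d'} → δx d ≡ δx d' → δy d ≡ δy d' → d ≡ d'
δ-injective {zero} {zero} _ _ = refl
δ-injective {zero} {suc zero} () _
δ-injective {zero} {suc (suc zero)} _ ()
δ-injective {suc zero} {zero} () _
δ-injective {suc zero} {suc zero} _ _ = refl
δ-injective {suc zero} {suc (suc zero)} () _
δ-injective {suc (suc zero)} {zero} _ ()
δ-injective {suc (suc zero)} {suc zero} () _
δ-injective {suc (suc zero)} {suc (suc zero)} _ _ = refl

neighbour : V → Dir → V
neighbour (false , a , b) d = B (a - δx d) (b - δy d)
neighbour (true  , a , b) d = W (a + δx d) (b + δy d)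

i-j+j≡i : ∀ i j → (i - j) + j ≡ i
i-j+j≡i = solve-∀

i+j-j≡i : ∀ i j → (i + j) - j ≡ i
i+j-j≡i = solve-∀

neighbour-involutive : ∀ u d → neighbour (neighbour u d) d ≡ u
neighbour-involutive (false , a , b) d = cong₂ W (i-j+j≡i a (δx d)) (i-j+j≡i b (δy d))
neighbour-involutive (true  , a , b) d = cong₂ B (i+j-j≡i a (δx d)) (i+j-j≡i b (δy d))

neighbour-injective : ∀ u {d d'} → neighbour u d ≡ neighbour u d' → d ≡ d'
neighbour-injective (false , a , b) eq = δ-injective
  (ℤ.neg-injective (+-cancelˡ a _ _ (cong (proj₁ ∘ proj₂) eq)))
  (ℤ.neg-injective (+-cancelˡ b _ _ (cong (proj₂ ∘ proj₂) eq)))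
neighbour-injective (true  , a , b) eq = δ-injective
  (+-cancelˡ a _ _ (cong (proj₁ ∘ proj₂) eq))
  (+-cancelˡ b _ _ (cong (proj₂ ∘ proj₂) eq))

adj⇒neighbour : ∀ {u v} → Adj u v → ∃ λ d → v ≡ neighbour u d
adj⇒neighbour (e₀ a b) = zero , cong₂ B (≡.sym (ℤ.+-identityʳ a)) (≡.sym (ℤ.+-identityʳ b))
adj⇒neighbour (e₁ a b) = suc zero , cong (B (a - 1ℤ)) (≡.sym (ℤ.+-identityʳ b))
adj⇒neighbour (e₂ a b) = suc (suc zero) , cong (λ x → B x (b - 1ℤ)) (≡.sym (ℤ.+-identityʳ a))
adj⇒neighbour {v = v} (sym p) with d , refl ← adj⇒neighbour p = d , ≡.sym (neighbour-involutive v d)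

adj-neighbour : ∀ {u v} (e : Adj u v) → Adj u (neighbour u (proj₁ (adj⇒neighbour e)))
adj-neighbour e = subst (Adj _) (proj₂ (adj⇒neighbour e)) e

white-neighbour-adj : ∀ a b d → Adj (W a b) (neighbour (W a b) d)
white-neighbour-adj a b zero             = adj-neighbour (e₀ a b)
white-neighbour-adj a b (suc zero)       = adj-neighbour (e₁ a b)
white-neighbour-adj a b (suc (suc zero)) = adj-neighbour (e₂ a b)

neighbour-adj : ∀ u d → Adj u (neighbour u d)
neighbour-adj (false , a , b) d = white-neighbour-adj a b d
neighbour-adj (true  , a , b) d =
  subst (λ u → Adj u (neighbour (B a b) d)) (neighbour-involutive (B a b) d)
        (sym (white-neighbour-adj (a + δx d) (b + δy d) d))

_≟V_ : DecidableEquality V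
_≟V_ = ≡-dec Bool._≟_ (≡-dec ℤ._≟_ ℤ._≟_)

Dir-covered : ∀ (d₁ d₂ d₃ d : Dir) → d₁ ≢ d₂ → d₁ ≢ d₃ → d₂ ≢ d₃ → d ≡ d₁ ⊎ d ≡ d₂ ⊎ d ≡ d₃
Dir-covered = from-yes (Fin.all? {3} λ d₁ → Fin.all? λ d₂ → Fin.all? λ d₃ → Fin.all? λ d →
  ¬? (d₁ Fin.≟ d₂) →-dec ¬? (d₁ Fin.≟ d₃) →-dec ¬? (d₂ Fin.≟ d₃) →-dec
  ((d Fin.≟ d₁) ⊎-dec (d Fin.≟ d₂) ⊎-dec (d Fin.≟ d₃)))

at-most-three-neighbours : ∀ {u v₁ v₂ v₃ w} → Adj u v₁ → Adj u v₂ → Adj u v₃ →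
  v₁ ≢ v₂ → v₁ ≢ v₃ → v₂ ≢ v₃ → Adj u w → w ≡ v₁ ⊎ w ≡ v₂ ⊎ w ≡ v₃
at-most-three-neighbours {u} a₁ a₂ a₃ v₁≢v₂ v₁≢v₃ v₂≢v₃ a
  with d₁ , refl ← adj⇒neighbour a₁ | d₂ , refl ← adj⇒neighbour a₂
     | d₃ , refl ← adj⇒neighbour a₃ | d  , refl ← adj⇒neighbour a
  = Sum.map N (Sum.map N N)
      (Dir-covered d₁ d₂ d₃ d (v₁≢v₂ ∘ N) (v₁≢v₃ ∘ N) (v₂≢v₃ ∘ N))
  where
  N : ∀ {d d'} → d ≡ d' → neighbour u d ≡ neighbour u d'
  N = cong (neighbour u)

-- Closed walks of length six

walk : V → List Dir → V
walk u [] = u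
walk u (d ∷ ds) = walk (neighbour u d) ds

translate : ℤ → ℤ → V → V
translate a b (c , x , y) = c , a + x , b + y

translate-neighbour : ∀ a b u d → translate a b (neighbour u d) ≡ neighbour (translate a b u) d
translate-neighbour a b (false , x , y) d =
  cong₂ B (≡.sym (ℤ.+-assoc a x (- δx d))) (≡.sym (ℤ.+-assoc b y (- δy d)))
translate-neighbour a b (true  , x , y) d =
  cong₂ W (≡.sym (ℤ.+-assoc a x (δx d))) (≡.sym (ℤ.+-assoc b y (δy d)))

walk-translate : ∀ a b u ds → walk (translate a b u) ds ≡ translate a b (walk u ds)
walk-translate a b u [] = refl
walk-translate a b u (d ∷ ds) =
  trans (cong (λ v → walk v ds) (≡.sym (translate-neighbour a b u d))) (walk-translate a b _ ds)

origin : Bool → V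
origin c = c , 0ℤ , 0ℤ

closed-walk-at-origin : ∀ u ds → walk u ds ≡ u → walk (origin (proj₁ u)) ds ≡ origin (proj₁ u)
closed-walk-at-origin u@(c , a , b) ds closed = begin
  walk (origin c) ds ≡⟨ cong (λ v → walk v ds) to-origin ⟨
  walk (t u) ds      ≡⟨ walk-translate (- a) (- b) u ds ⟩
  t (walk u ds)      ≡⟨ cong t closed ⟩
  t u                ≡⟨ to-origin ⟩
  origin c           ∎
  where
  open ≡-Reasoning
  t = translate (- a) (- b)
  to-origin : t u ≡ origin c
  to-origin = cong₂ (λ x y → c , x , y) (ℤ.+-inverseˡ a) (ℤ.+-inverseˡ b)

third : Dir → Dir → Dir
third zero (suc zero) = suc (suc zero)
third (suc zero) zero = suc (suc zero)
third zero (suc (suc zero)) = suc zero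
third (suc (suc zero)) zero = suc zero
third _ _ = zero

-- A closed walk of length six without backtracking goes around a hexagon, each step taking the
-- direction not used by the two before it. By translation it suffices to check walks from the
-- origin, a finite computation.
ClosedWalk₆Turns : Bool → Set
ClosedWalk₆Turns c = ∀ d₀ d₁ d₂ d₃ d₄ d₅ →
  d₀ ≢ d₁ → d₁ ≢ d₂ → d₂ ≢ d₃ → d₃ ≢ d₄ → d₄ ≢ d₅ → d₅ ≢ d₀ →
  walk (origin c) (d₀ ∷ d₁ ∷ d₂ ∷ d₃ ∷ d₄ ∷ d₅ ∷ []) ≡ origin c →
  d₂ ≡ third d₁ d₀

closed-walk₆-turns? : ∀ c → Dec (ClosedWalk₆Turns c)
closed-walk₆-turns? c =
  Fin.all? λ d₀ → Fin.all? λ d₁ → Fin.all? λ d₂ → Fin.all? λ d₃ → Fin.all? λ d₄ → Fin.all? λ d₅ →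
  ¬? (d₀ Fin.≟ d₁) →-dec ¬? (d₁ Fin.≟ d₂) →-dec ¬? (d₂ Fin.≟ d₃) →-dec
  ¬? (d₃ Fin.≟ d₄) →-dec ¬? (d₄ Fin.≟ d₅) →-dec ¬? (d₅ Fin.≟ d₀) →-dec
  (walk (origin c) (d₀ ∷ d₁ ∷ d₂ ∷ d₃ ∷ d₄ ∷ d₅ ∷ []) ≟V origin c) →-dec (d₂ Fin.≟ third d₁ d₀)

closed-walk₆-turns : ∀ c → ClosedWalk₆Turns c
closed-walk₆-turns false = from-yes (closed-walk₆-turns? false)
closed-walk₆-turns true  = from-yes (closed-walk₆-turns? true)

next^ : ℕ → Fin 6 → Fin 6
next^ ℕ.zero k = k
next^ (ℕ.suc n) k = next^ n (next k)

prev : Fin 6 → Fin 6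
prev = next^ 5

prev-next : ∀ k → prev (next k) ≡ k
prev-next = from-yes (Fin.all? λ k → prev (next k) Fin.≟ k)

next-prev : ∀ k → next (prev k) ≡ k
next-prev = from-yes (Fin.all? λ k → next (prev k) Fin.≟ k)

next²≢id : ∀ k → next (next k) ≢ k
next²≢id = from-yes (Fin.all? λ k → ¬? (next (next k) Fin.≟ k))

prev≢next : ∀ k → prev k ≢ next k
prev≢next = from-yes (Fin.all? λ k → ¬? (prev k Fin.≟ next k))

next-orbit : ∀ k i → ∃ λ (n : Fin 6) → next^ (toℕ n) k ≡ i
next-orbit = from-yes (Fin.all? λ k → Fin.all? λ i → Fin.any? {6} λ n → next^ (toℕ n) k Fin.≟ i)

-- Cycle6Embedding y is read as "y is a 6-cycle of G(H)".
module Cycle6 {y : Fin 6 → V} (cycle : Cycle6Embedding y) where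
  open Cycle6Embedding cycle

  direction : Fin 6 → Dir
  direction k = proj₁ (adj⇒neighbour (edges k))

  direction-spec : ∀ k → y (next k) ≡ neighbour (y k) (direction k)
  direction-spec k = proj₂ (adj⇒neighbour (edges k))

  no-backtracking : ∀ k → direction k ≢ direction (next k)
  no-backtracking k eq = next²≢id k (injective _ _ (begin
    y (next (next k))                                      ≡⟨ direction-spec (next k) ⟩
    neighbour (y (next k)) (direction (next k))            ≡⟨ cong₂ neighbour (direction-spec k) (≡.sym eq) ⟩
    neighbour (neighbour (y k) (direction k)) (direction k) ≡⟨ neighbour-involutive (y k) (direction k) ⟩
    y k                                                    ∎))
    where open ≡-Reasoning

  walk-around : ∀ n k → walk (y k) (map direction (iterate next k n)) ≡ y (next^ n k)
  walk-around ℕ.zero k = refl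
  walk-around (ℕ.suc n) k =
    trans (cong (λ v → walk v (map direction (iterate next (next k) n))) (≡.sym (direction-spec k)))
          (walk-around n (next k))

  turn : ∀ k → direction (next (next k)) ≡ third (direction (next k)) (direction k)
  turn k = closed-walk₆-turns (proj₁ (y k)) _ _ _ _ _ _
    (no-backtracking k) (no-backtracking (next k)) (no-backtracking (next^ 2 k))
    (no-backtracking (next^ 3 k)) (no-backtracking (next^ 4 k))
    (subst (λ j → direction (next^ 5 k) ≢ direction j) (prev-next k) (no-backtracking (next^ 5 k)))
    (closed-walk-at-origin (y k) (map direction (iterate next k 6)) (trans (walk-around 6 k) (cong y (prev-next k))))

module _ {y z : Fin 6 → V} (cy : Cycle6Embedding y) (cz : Cycle6Embedding z) where
  private
    module Y = Cycle6 cy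
    module Z = Cycle6 cz

    Agree : Fin 6 → Set
    Agree k = y k ≡ z k

    Agree₃ : Fin 6 → Set
    Agree₃ k = Agree k × Agree (next k) × Agree (next (next k))

    directions-agree : ∀ {k} → Agree k → Agree (next k) → Y.direction k ≡ Z.direction k
    directions-agree {k} p q = neighbour-injective (y k) (begin
      neighbour (y k) (Y.direction k) ≡⟨ Y.direction-spec k ⟨
      y (next k)                      ≡⟨ q ⟩
      z (next k)                      ≡⟨ Z.direction-spec k ⟩
      neighbour (z k) (Z.direction k) ≡⟨ cong (λ v → neighbour v (Z.direction k)) p ⟨
      neighbour (y k) (Z.direction k) ∎)
      where open ≡-Reasoning

    agree₃-next : ∀ k → Agree₃ k → Agree₃ (next k)
    agree₃-next k (p₀ , p₁ , p₂) = p₁ , p₂ , (begin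
      y (next k₂)                           ≡⟨ Y.direction-spec k₂ ⟩
      neighbour (y k₂) (Y.direction k₂)     ≡⟨ cong₂ neighbour p₂ turn-agrees ⟩
      neighbour (z k₂) (Z.direction k₂)     ≡⟨ Z.direction-spec k₂ ⟨
      z (next k₂)                           ∎)
      where
      open ≡-Reasoning
      k₂ = next (next k)
      turn-agrees : Y.direction k₂ ≡ Z.direction k₂
      turn-agrees = begin
        Y.direction k₂                                   ≡⟨ Y.turn k ⟩
        third (Y.direction (next k)) (Y.direction k)     ≡⟨ cong₂ third (directions-agree p₁ p₂) (directions-agree p₀ p₁) ⟩
        third (Z.direction (next k)) (Z.direction k)     ≡⟨ Z.turn k ⟨
        Z.direction k₂                                   ∎

    agree₃-around : ∀ n k → Agree₃ k → Agree (next^ n k)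
    agree₃-around ℕ.zero k a = proj₁ a
    agree₃-around (ℕ.suc n) k a = agree₃-around n (next k) (agree₃-next k a)

  cycles-agree : ∀ k → Agree (prev k) → Agree k → Agree (next k) → ∀ i → Agree i
  cycles-agree k p₀ p₁ p₂ i with n , refl ← next-orbit (prev k) i =
    agree₃-around (toℕ n) (prev k)
      (p₀ , subst Agree (≡.sym (next-prev k)) p₁ , subst Agree (≡.sym (cong next (next-prev k))) p₂)

-- Automorphisms of the honeycomb

record Automorphism : Set where
  field
    to from      : V → V
    from-to      : ∀ u → from (to u) ≡ u
    to-from      : ∀ u → to (from u) ≡ u
    relabel      : Dir → Dir
    relabel-onto : ∀ d → ∃ λ d' → relabel d' ≡ d
    to-neighbour : ∀ u d → to (neighbour u d) ≡ neighbour (to u) (relabel d)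

  to-injective : ∀ {u v} → to u ≡ to v → u ≡ v
  to-injective {u} {v} eq = trans (≡.sym (from-to u)) (trans (cong from eq) (from-to v))

  to-adj : ∀ {u v} → Adj u v → Adj (to u) (to v)
  to-adj {u} a with d , refl ← adj⇒neighbour a =
    subst (Adj (to u)) (≡.sym (to-neighbour u d)) (neighbour-adj (to u) (relabel d))

  relabel-injective : ∀ {d d'} → relabel d ≡ relabel d' → d ≡ d'
  relabel-injective {d} {d'} eq = neighbour-injective o (to-injective (begin
    to (neighbour o d)            ≡⟨ to-neighbour o d ⟩
    neighbour (to o) (relabel d)  ≡⟨ cong (neighbour (to o)) eq ⟩
    neighbour (to o) (relabel d') ≡⟨ to-neighbour o d' ⟨
    to (neighbour o d')           ∎))
    where
    open ≡-Reasoning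
    o = origin false

  from-neighbour : ∀ u d → from (neighbour u d) ≡ neighbour (from u) (proj₁ (relabel-onto d))
  from-neighbour u d with d' , refl ← relabel-onto d = begin
    from (neighbour u (relabel d'))             ≡⟨ cong (λ v → from (neighbour v (relabel d'))) (to-from u) ⟨
    from (neighbour (to (from u)) (relabel d')) ≡⟨ cong from (to-neighbour (from u) d') ⟨
    from (to (neighbour (from u) d'))           ≡⟨ from-to _ ⟩
    neighbour (from u) d'                       ∎
    where open ≡-Reasoning

open Automorphism

infix 30 _⁻¹
_⁻¹ : Automorphism → Automorphism
A ⁻¹ = record
  { to           = from A
  ; from         = to A
  ; from-to      = to-from A
  ; to-from      = from-to A
  ; relabel      = proj₁ ∘ relabel-onto A
  ; relabel-onto = λ d → relabel A d , relabel-injective A (proj₂ (relabel-onto A (relabel A d)))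
  ; to-neighbour = from-neighbour A
  }

infixr 20 _∘ᴬ_
_∘ᴬ_ : Automorphism → Automorphism → Automorphism
G ∘ᴬ F = record
  { to           = to G ∘ to F
  ; from         = from F ∘ from G
  ; from-to      = λ u → trans (cong (from F) (from-to G (to F u))) (from-to F u)
  ; to-from      = λ u → trans (cong (to G) (to-from F (from G u))) (to-from G u)
  ; relabel      = relabel G ∘ relabel F
  ; relabel-onto = onto
  ; to-neighbour = λ u d → trans (cong (to G) (to-neighbour F u d)) (to-neighbour G (to F u) (relabel F d))
  }
  where
  onto : ∀ d → ∃ λ d' → relabel G (relabel F d') ≡ d
  onto d with d₁ , refl ← relabel-onto G d with d₂ , refl ← relabel-onto F d₁ = d₂ , refl

idᴬ : Automorphism
idᴬ = record
  { to = λ u → u ; from = λ u → u ; from-to = λ _ → refl ; to-from = λ _ → refl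
  ; relabel = λ d → d ; relabel-onto = λ d → d , refl ; to-neighbour = λ _ _ → refl }

involution : (f : V → V) → (∀ u → f (f u) ≡ u) → (π : Dir → Dir) → (∀ d → π (π d) ≡ d) →
             (∀ u d → f (neighbour u d) ≡ neighbour (f u) (π d)) → Automorphism
involution f f-involutive π π-involutive f-neighbour = record
  { to = f ; from = f ; from-to = f-involutive ; to-from = f-involutive
  ; relabel = π ; relabel-onto = λ d → π d , π-involutive d ; to-neighbour = f-neighbour }

translation : ℤ → ℤ → Automorphism
translation a b = record
  { to           = translate a b
  ; from         = translate (- a) (- b)
  ; from-to      = λ { (c , x , y) → cong₂ (λ x y → c , x , y) (-i+[i+j]≡j a x) (-i+[i+j]≡j b y) }
  ; to-from      = λ { (c , x , y) → cong₂ (λ x y → c , x , y) (i+[-i+j]≡j a x) (i+[-i+j]≡j b y) }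
  ; relabel      = λ d → d
  ; relabel-onto = λ d → d , refl
  ; to-neighbour = translate-neighbour a b
  }
  where
  -i+[i+j]≡j : ∀ i j → - i + (i + j) ≡ j
  -i+[i+j]≡j = solve-∀

  i+[-i+j]≡j : ∀ i j → i + (- i + j) ≡ j
  i+[-i+j]≡j = solve-∀

invert-vertex : V → V
invert-vertex (c , x , y) = not c , - x , - y

invert : Automorphism
invert = involution invert-vertex involutive (λ d → d) (λ _ → refl) invert-neighbour
  where
  involutive : ∀ u → invert-vertex (invert-vertex u) ≡ u
  involutive (false , x , y) = cong₂ W (ℤ.neg-involutive x) (ℤ.neg-involutive y)
  involutive (true  , x , y) = cong₂ B (ℤ.neg-involutive x) (ℤ.neg-involutive y)

  -[i-j]≡-i+j : ∀ i j → - (i - j) ≡ - i + j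
  -[i-j]≡-i+j = solve-∀

  invert-neighbour : ∀ u d → invert-vertex (neighbour u d) ≡ neighbour (invert-vertex u) d
  invert-neighbour (false , x , y) d = cong₂ W (-[i-j]≡-i+j x (δx d)) (-[i-j]≡-i+j y (δy d))
  invert-neighbour (true  , x , y) d = cong₂ B (ℤ.neg-distrib-+ x (δx d)) (ℤ.neg-distrib-+ y (δy d))

swap₁₂ swap₀₁ : Dir → Dir
swap₁₂ zero = zero
swap₁₂ (suc zero) = suc (suc zero)
swap₁₂ (suc (suc zero)) = suc zero
swap₀₁ zero = suc zero
swap₀₁ (suc zero) = zero
swap₀₁ (suc (suc zero)) = suc (suc zero)

swap₁₂-involutive : ∀ d → swap₁₂ (swap₁₂ d) ≡ d
swap₁₂-involutive = from-yes (Fin.all? λ d → swap₁₂ (swap₁₂ d) Fin.≟ d)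

swap₀₁-involutive : ∀ d → swap₀₁ (swap₀₁ d) ≡ d
swap₀₁-involutive = from-yes (Fin.all? λ d → swap₀₁ (swap₀₁ d) Fin.≟ d)

reflect₀-vertex : V → V
reflect₀-vertex (c , x , y) = c , y , x

reflect₀ : Automorphism
reflect₀ = involution reflect₀-vertex (λ _ → refl) swap₁₂ swap₁₂-involutive reflect₀-neighbour
  where
  reflect₀-neighbour : ∀ u d → reflect₀-vertex (neighbour u d) ≡ neighbour (reflect₀-vertex u) (swap₁₂ d)
  reflect₀-neighbour (false , _) zero             = refl
  reflect₀-neighbour (false , _) (suc zero)       = refl
  reflect₀-neighbour (false , _) (suc (suc zero)) = refl
  reflect₀-neighbour (true  , _) zero             = refl
  reflect₀-neighbour (true  , _) (suc zero)       = refl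
  reflect₀-neighbour (true  , _) (suc (suc zero)) = refl

reflect₂-vertex : V → V
reflect₂-vertex (false , x , y) = W (- x - y) y
reflect₂-vertex (true  , x , y) = B (- x - y - 1ℤ) y

reflect₂ : Automorphism
reflect₂ = involution reflect₂-vertex involutive swap₀₁ swap₀₁-involutive reflect₂-neighbour
  where
  white-involutive : ∀ x y → - (- x - y) - y ≡ x
  white-involutive = solve-∀

  black-involutive : ∀ x y → - (- x - y - 1ℤ) - y - 1ℤ ≡ x
  black-involutive = solve-∀

  involutive : ∀ u → reflect₂-vertex (reflect₂-vertex u) ≡ u
  involutive (false , x , y) = cong (λ a → W a y) (white-involutive x y)
  involutive (true  , x , y) = cong (λ a → B a y) (black-involutive x y)

  δx-swap₀₁ : ∀ d → 1ℤ - δx d - δy d ≡ δx (swap₀₁ d)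
  δx-swap₀₁ = from-yes (Fin.all? λ d → (1ℤ - δx d - δy d) ℤ.≟ δx (swap₀₁ d))

  δy-swap₀₁ : ∀ d → δy d ≡ δy (swap₀₁ d)
  δy-swap₀₁ = from-yes (Fin.all? λ d → δy d ℤ.≟ δy (swap₀₁ d))

  white-neighbour : ∀ x y p q → - (x - p) - (y - q) - 1ℤ ≡ (- x - y) - (1ℤ - p - q)
  white-neighbour = solve-∀

  black-neighbour : ∀ x y p q → - (x + p) - (y + q) ≡ (- x - y - 1ℤ) + (1ℤ - p - q)
  black-neighbour = solve-∀

  reflect₂-neighbour : ∀ u d → reflect₂-vertex (neighbour u d) ≡ neighbour (reflect₂-vertex u) (swap₀₁ d)
  reflect₂-neighbour (false , x , y) d = cong₂ B
    (trans (white-neighbour x y (δx d) (δy d)) (cong (λ e → - x - y - e) (δx-swap₀₁ d)))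
    (cong (λ e → y - e) (δy-swap₀₁ d))
  reflect₂-neighbour (true  , x , y) d = cong₂ W
    (trans (black-neighbour x y (δx d) (δy d)) (cong (λ e → - x - y - 1ℤ + e) (δx-swap₀₁ d)))
    (cong (λ e → y + e) (δy-swap₀₁ d))

Frames : V → Dir → Dir → Set
Frames p d e = Σ Automorphism λ F → to F (origin false) ≡ p × relabel F zero ≡ d × relabel F (suc zero) ≡ e

stabiliser : ∀ d e → d ≢ e → Frames (origin false) d e
stabiliser zero             zero             d≢e = ⊥-elim (d≢e refl)
stabiliser zero             (suc zero)       _   = idᴬ , refl , refl , refl
stabiliser zero             (suc (suc zero)) _   = reflect₀ , refl , refl , refl
stabiliser (suc zero)       zero             _   = reflect₂ , refl , refl , refl
stabiliser (suc zero)       (suc zero)       d≢e = ⊥-elim (d≢e refl)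
stabiliser (suc zero)       (suc (suc zero)) _   = reflect₂ ∘ᴬ reflect₀ , refl , refl , refl
stabiliser (suc (suc zero)) zero             _   = reflect₀ ∘ᴬ reflect₂ , refl , refl , refl
stabiliser (suc (suc zero)) (suc zero)       _   = reflect₂ ∘ᴬ (reflect₀ ∘ᴬ reflect₂) , refl , refl , refl
stabiliser (suc (suc zero)) (suc (suc zero)) d≢e = ⊥-elim (d≢e refl)

frame : ∀ p d e → d ≢ e → Frames p d e
frame (false , a , b) d e d≢e with M , fixes , Md , Me ← stabiliser d e d≢e =
  translation a b ∘ᴬ M ,
  trans (cong (translate a b) fixes) (cong₂ W (ℤ.+-identityʳ a) (ℤ.+-identityʳ b)) , Md , Me
frame (true  , a , b) d e d≢e with M , fixes , Md , Me ← stabiliser d e d≢e =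
  translation a b ∘ᴬ (invert ∘ᴬ M) ,
  trans (cong (translate a b ∘ invert-vertex) fixes) (cong₂ B (ℤ.+-identityʳ a) (ℤ.+-identityʳ b)) , Md , Me

module _ (F G : Automorphism) where
  private
    A : Automorphism
    A = G ∘ᴬ F ⁻¹

  transfer-base : ∀ u → to A (to F u) ≡ to G u
  transfer-base u = cong (to G) (from-to F u)

  transfer-neighbour : ∀ u d → to A (neighbour (to F u) (relabel F d)) ≡ neighbour (to G u) (relabel G d)
  transfer-neighbour u d = begin
    to A (neighbour (to F u) (relabel F d)) ≡⟨ cong (to A) (to-neighbour F u d) ⟨
    to A (to F (neighbour u d))             ≡⟨ transfer-base (neighbour u d) ⟩
    to G (neighbour u d)                    ≡⟨ to-neighbour G u d ⟩
    neighbour (to G u) (relabel G d)        ∎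
    where open ≡-Reasoning

two-arc-transitive : ∀ {p v w q v' w'} → Adj p v → Adj p w → v ≢ w → Adj q v' → Adj q w' → v' ≢ w' →
  Σ Automorphism λ A → to A p ≡ q × to A v ≡ v' × to A w ≡ w'
two-arc-transitive {p} {q = q} pv pw v≢w qv' qw' v'≢w'
  with d  , refl ← adj⇒neighbour pv  | e  , refl ← adj⇒neighbour pw
     | d' , refl ← adj⇒neighbour qv' | e' , refl ← adj⇒neighbour qw'
  with F , refl , refl , refl ← frame p d e (v≢w ∘ cong (neighbour p))
     | G , refl , refl , refl ← frame q d' e' (v'≢w' ∘ cong (neighbour q))
  = G ∘ᴬ F ⁻¹ , transfer-base F G o , transfer-neighbour F G o zero , transfer-neighbour F G o (suc zero)
  where
  o : V
  o = origin false

open Cycle6Embedding using () renaming (injective to cycle-injective; edges to cycle-edges)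

image-cycle : ∀ {y} (A : Automorphism) → Cycle6Embedding y → Cycle6Embedding (to A ∘ y)
image-cycle A cy = record
  { injective = λ i j → cycle-injective cy i j ∘ to-injective A
  ; edges     = to-adj A ∘ cycle-edges cy
  }

cycle-neighbours-distinct : ∀ {y} → Cycle6Embedding y → ∀ k → y (next k) ≢ y (prev k)
cycle-neighbours-distinct cy k = prev≢next k ∘ ≡.sym ∘ cycle-injective cy (next k) (prev k)

automorphism-between-cycles : ∀ {y z} → Cycle6Embedding y → Cycle6Embedding z → Σ Automorphism λ A → ∀ i → to A (y i) ≡ z i
automorphism-between-cycles cy cz
  with A , A₀ , A₁ , A₅ ← two-arc-transitive
         (cycle-edges cy zero) (sym (cycle-edges cy (prev zero))) (cycle-neighbours-distinct cy zero)
         (cycle-edges cz zero) (sym (cycle-edges cz (prev zero))) (cycle-neighbours-distinct cz zero)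
  = A , cycles-agree (image-cycle A cy) cz zero A₅ A₀ A₁

-- Hexagons of a coronoid

cycle-cong : ∀ {y z} → (∀ i → y i ≡ z i) → Cycle6Embedding y → Cycle6Embedding z
cycle-cong {y} {z} y≗z cy = record
  { injective = λ i j eq → cycle-injective cy i j (trans (y≗z i) (trans eq (≡.sym (y≗z j))))
  ; edges     = λ i → subst₂ Adj (y≗z i) (y≗z (next i)) (cycle-edges cy i)
  }

hexagon₀ : Fin 6 → V
hexagon₀ = hexVertex (0ℤ , 0ℤ)

hexagon₀-cycle : Cycle6Embedding hexagon₀
hexagon₀-cycle = record
  { injective = from-yes (Fin.all? λ i → Fin.all? λ j → (hexagon₀ i ≟V hexagon₀ j) →-dec (i Fin.≟ j))
  ; edges     = edges
  }
  where
  edges : ∀ i → Adj (hexagon₀ i) (hexagon₀ (next i))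
  edges zero                                = neighbour-adj _ (suc zero)
  edges (suc zero)                          = neighbour-adj _ (suc (suc zero))
  edges (suc (suc zero))                    = neighbour-adj _ zero
  edges (suc (suc (suc zero)))              = neighbour-adj _ (suc zero)
  edges (suc (suc (suc (suc zero))))        = neighbour-adj _ (suc (suc zero))
  edges (suc (suc (suc (suc (suc zero))))) = neighbour-adj _ zero

hexagon-translate : ∀ a b i → translate a b (hexagon₀ i) ≡ hexVertex (a , b) i
hexagon-translate a b zero                                = cong₂ B (ℤ.+-identityʳ a) (ℤ.+-identityʳ b)
hexagon-translate a b (suc zero)                          = cong (W (a + 1ℤ)) (ℤ.+-identityʳ b)
hexagon-translate a b (suc (suc zero))                    = refl
hexagon-translate a b (suc (suc (suc zero)))              = refl
hexagon-translate a b (suc (suc (suc (suc zero))))        = cong (λ x → B x (b - 1ℤ)) (ℤ.+-identityʳ a)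
hexagon-translate a b (suc (suc (suc (suc (suc zero))))) = cong₂ W (ℤ.+-identityʳ a) (ℤ.+-identityʳ b)

hexagon-cycle : ∀ h → Cycle6Embedding (hexVertex h)
hexagon-cycle (a , b) = cycle-cong (hexagon-translate a b) (image-cycle (translation a b) hexagon₀-cycle)

edgeOn-adj : ∀ {h u v} → EdgeOn h u v → Adj u v
edgeOn-adj {h} (i , inj₁ (refl , refl)) = cycle-edges (hexagon-cycle h) i
edgeOn-adj {h} (i , inj₂ (refl , refl)) = sym (cycle-edges (hexagon-cycle h) i)

edgeOn-centred : ∀ {h u v} → EdgeOn h u v →
  ∃ λ k → u ≡ hexVertex h k × (v ≡ hexVertex h (next k) ⊎ v ≡ hexVertex h (prev k))
edgeOn-centred     (j , inj₁ (refl , refl)) = j , refl , inj₁ refl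
edgeOn-centred {h} (j , inj₂ (refl , refl)) = next j , refl , inj₂ (cong (hexVertex h) (≡.sym (prev-next j)))

module _ {K : List Hex} where

  edgeK-adj : ∀ {u v} → EdgeK K u v → Adj u v
  edgeK-adj (_ , _ , uv) = edgeOn-adj uv

  edgeK-sym : ∀ {u v} → EdgeK K u v → EdgeK K v u
  edgeK-sym (h , h∈K , i , uv) = h , h∈K , i , Sum.swap uv

  edgeK-vertexˡ : ∀ {u v} → EdgeK K u v → VertexK K u
  edgeK-vertexˡ (h , h∈K , i , inj₁ (u≡ , _)) = h , h∈K , i , u≡
  edgeK-vertexˡ (h , h∈K , i , inj₂ (_ , u≡)) = h , h∈K , next i , u≡

  edgeK-vertexʳ : ∀ {u v} → EdgeK K u v → VertexK K v
  edgeK-vertexʳ = edgeK-vertexˡ ∘ edgeK-sym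

  hexagon-edge : ∀ {h} → h ∈ K → ∀ i → EdgeK K (hexVertex h i) (hexVertex h (next i))
  hexagon-edge h∈K i = _ , h∈K , i , inj₁ (refl , refl)

  hexagon-edge⁻ : ∀ {h} → h ∈ K → ∀ i → EdgeK K (hexVertex h i) (hexVertex h (prev i))
  hexagon-edge⁻ {h} h∈K i = h , h∈K , prev i , inj₂ (refl , cong (hexVertex h) (next-prev i))

  hexagon-image : ∀ {g h} → EmbeddingK K g → h ∈ K → Cycle6Embedding (g ∘ hexVertex h)
  hexagon-image {h = h} emb h∈K = record
    { injective = λ i j → cycle-injective (hexagon-cycle h) i j
                        ∘ EmbeddingK.injective emb _ _ (h , h∈K , i , refl) (h , h∈K , j , refl)
    ; edges     = λ i → EmbeddingK.edges emb _ _ (hexagon-edge h∈K i)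
    }

  images-distinct : ∀ {g u s t} → EmbeddingK K g → EdgeK K u s → EdgeK K u t → s ≢ t → g s ≢ g t
  images-distinct emb us ut s≢t = s≢t ∘ EmbeddingK.injective emb _ _ (edgeK-vertexʳ us) (edgeK-vertexʳ ut)

module Rigidity {K : List Hex} {g g' : V → V} (emb : EmbeddingK K g) (emb' : EmbeddingK K g') where
  private
    module E  = EmbeddingK emb
    module E' = EmbeddingK emb'

  Agree : V → Set
  Agree u = g u ≡ g' u

  AgreeOn : Hex → Set
  AgreeOn h = ∀ i → Agree (hexVertex h i)

  -- g u has only three neighbours, and g' sends x to one of them other than g v = g' v and g y = g' y.
  agree-third-neighbour : ∀ {u v x y} → EdgeK K u v → EdgeK K u x → EdgeK K u y → x ≢ v → y ≢ v →
    Agree u → Agree v → Agree y → Agree x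
  agree-third-neighbour {u} {v} {x} {y} uv ux uy x≢v y≢v au av ay with x ≟V y
  ... | yes refl = ay
  ... | no x≢y
    with at-most-three-neighbours (E.edges _ _ uv) (E.edges _ _ uy) (E.edges _ _ ux)
           (images-distinct emb uv uy (y≢v ∘ ≡.sym)) (images-distinct emb uv ux (x≢v ∘ ≡.sym))
           (images-distinct emb uy ux (x≢y ∘ ≡.sym))
           (subst (λ w → Adj w (g' x)) (≡.sym au) (E'.edges _ _ ux))
  ... | inj₁ g'x≡gv        = ⊥-elim (images-distinct emb' ux uv x≢v (trans g'x≡gv av))
  ... | inj₂ (inj₁ g'x≡gy) = ⊥-elim (images-distinct emb' ux uy x≢y (trans g'x≡gy ay))
  ... | inj₂ (inj₂ g'x≡gx) = ≡.sym g'x≡gx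

  agree-hexagon : ∀ {h u v y} → h ∈ K → EdgeOn h u v → EdgeK K u y → y ≢ v →
    Agree u → Agree v → Agree y → AgreeOn h
  agree-hexagon {h} h∈K uv uy y≢v au av ay with edgeOn-centred uv
  ... | k , refl , inj₁ refl = cycles-agree (hexagon-image emb h∈K) (hexagon-image emb' h∈K) k ax au av
    where
    ax : Agree (hexVertex h (prev k))
    ax = agree-third-neighbour (h , h∈K , uv) (hexagon-edge⁻ h∈K k) uy
           (cycle-neighbours-distinct (hexagon-cycle h) k ∘ ≡.sym) y≢v au av ay
  ... | k , refl , inj₂ refl = cycles-agree (hexagon-image emb h∈K) (hexagon-image emb' h∈K) k av au ax
    where
    ax : Agree (hexVertex h (next k))
    ax = agree-third-neighbour (h , h∈K , uv) (hexagon-edge h∈K k) uy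
           (cycle-neighbours-distinct (hexagon-cycle h) k) y≢v au av ay

  agree-adjacent : ∀ {h h'} → h ∈ K → h' ∈ K → HexAdj h h' → AgreeOn h → AgreeOn h'
  agree-adjacent {h} h∈K h'∈K (_ , _ , _ , uv , uv') agree with edgeOn-centred uv
  ... | k , refl , inj₁ refl = agree-hexagon h'∈K uv' (hexagon-edge⁻ h∈K k)
    (cycle-neighbours-distinct (hexagon-cycle h) k ∘ ≡.sym) (agree k) (agree (next k)) (agree (prev k))
  ... | k , refl , inj₂ refl = agree-hexagon h'∈K uv' (hexagon-edge h∈K k)
    (cycle-neighbours-distinct (hexagon-cycle h) k) (agree k) (agree (prev k)) (agree (next k))

  agree-along : ∀ {h h'} → PathIn K h h' → AgreeOn h → AgreeOn h'
  agree-along here agree = agree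
  agree-along (step h∈K h'∈K adjacent path) agree = agree-along path (agree-adjacent h∈K h'∈K adjacent agree)

embeddings-agree : ∀ {K g g' u v y} → Connected K → EmbeddingK K g → EmbeddingK K g' →
  EdgeK K u v → EdgeK K u y → y ≢ v → g u ≡ g' u → g v ≡ g' v → g y ≡ g' y →
  ∀ w → VertexK K w → g w ≡ g' w
embeddings-agree (_ , connected) emb emb' (h , h∈K , uv) uy y≢v au av ay w (h' , h'∈K , i , refl) =
  agree-along (connected h∈K h'∈K) (agree-hexagon h∈K uv uy y≢v au av ay) i
  where open Rigidity emb emb'

restrict : ∀ {K} (A : Automorphism) → EmbeddingK K (to A)
restrict A = record { injective = λ _ _ _ _ → to-injective A ; edges = λ _ _ → to-adj A ∘ edgeK-adj }

cycle-in-lattice : ∀ {K c} → Cycle6In K c → Cycle6Embedding c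
cycle-in-lattice cycle = record
  { injective = Cycle6In.injective cycle
  ; edges     = edgeK-adj ∘ Cycle6In.edges cycle
  }

theorem2p21 : (K : List Hex) → Coronoid K →
    (c : Fin 6 → V) → Cycle6In K c →
    (f : Fin 6 → V) → Cycle6Embedding f →
    Σ (V → V) (λ g → (EmbeddingK K g × Extends c f g) ×
      ((g' : V → V) → EmbeddingK K g' → Extends c f g' →
        (u : V) → VertexK K u → g' u ≡ g u))
theorem2p21 K connected c cycle f embedding with A , extends ← automorphism-between-cycles (cycle-in-lattice cycle) embedding =
  to A , (restrict A , extends) , unique
  where
  open Cycle6In cycle
  unique : (g' : V → V) → EmbeddingK K g' → Extends c f g' → (u : V) → VertexK K u → g' u ≡ to A u
  unique g' emb' extends' u u∈K = ≡.sym (embeddings-agree connected (restrict A) emb'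
    (edges zero) (edgeK-sym (edges (prev zero))) (cycle-neighbours-distinct (cycle-in-lattice cycle) zero ∘ ≡.sym)
    (agree zero) (agree (suc zero)) (agree (prev zero)) u u∈K)
    where
    agree : ∀ i → to A (c i) ≡ g' (c i)
    agree i = trans (extends i) (≡.sym (extends' i))
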